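{- Let $(\mathcal{C},\otimes,I)$ be a symmetric monoidal category, let $I$ also denote the constant family at $I$ in $[\mathbb{N},\mathcal{C}]$, and let $Y\in[\mathbb{N},\mathcal{C}]$. Then for every $n\in\mathbb{N}$ there are bijections $$\mathrm{Comb}_n(I,Y)\cong\mathcal{C}\Big(I,\textstyle\bigotimes_{i=0}^{n}Y_i\Big),\qquad \mathrm{Comb}_n^{+}(I,Y)\cong\int^{M\in\mathcal{C}}\mathcal{C}\Big(I,\big(\textstyle\bigotimes_{i=0}^{n}Y_i\big)\otimes M\Big),$$ and consequently a bijection $$\mathrm{Comb}_\infty(I,Y)\cong\varprojlim_n\int^{M\in\mathcal{C}}\mathcal{C}\Big(I,\big(\textstyle\bigotimes_{i=0}^{n}Y_i\big)\otimes M\Big),$$ where the inverse limit is along the maps corresponding, under the second bijection, to the projections $\mathrm{Comb}_{n+1}^+(I,Y)\to\mathrm{Comb}_n^+(I,Y)$.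
   Context: For families $X,Y\in[\mathbb{N},\mathcal{C}]$ (i.e. $\mathbb{N}$-indexed families of objects of $\mathcal{C}$), define the coends in sets $$\mathrm{Comb}_n(X,Y)=\int^{M_0,\dots,M_{n-1}\in\mathcal{C}}\prod_{i=0}^{n}\mathcal{C}(M_{i-1}\otimes X_i,\,M_i\otimes Y_i),\quad M_{ -1}=M_n:=I,$$ $$\mathrm{Comb}_n^{+}(X,Y)=\int^{M_0,\dots,M_n\in\mathcal{C}}\prod_{i=0}^{n}\mathcal{C}(M_{i-1}\otimes X_i,\,M_i\otimes Y_i),\quad M_{ -1}:=I.$$ Forgetting the last component gives well-defined projections $\mathrm{Comb}_{n+1}^+(X,Y)\to\mathrm{Comb}_n^+(X,Y)$, and $\mathrm{Comb}_\infty(X,Y):=\varprojlim_n\mathrm{Comb}_n^+(X,Y)$. -}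

module Defs where

open import Level using (Level; _⊔_) renaming (suc to lsuc)
open import Data.Nat using (ℕ; zero; suc)
open import Data.Product using (Σ; _,_; proj₁; proj₂; _×_)
open import Function using (_∘′_)
open import Function.Bundles using (Inverse)
open import Relation.Binary using (Rel; IsEquivalence; Setoid)
import Relation.Binary.Construct.Closure.Equivalence as EqC

record SymMonCat (o c ℓ : Level) : Set (lsuc (o ⊔ c ⊔ ℓ)) where
  infixr 9 _∘_
  infix  4 _≈_
  infix  5 _⇒_
  infixr 10 _⊗₀_ _⊗₁_
  field
    Obj : Set o
    _⇒_ : Obj → Obj → Set c
    _≈_ : ∀ {A B} → Rel (A ⇒ B) ℓ
    id  : ∀ {A} → A ⇒ A
    _∘_ : ∀ {A B C} → B ⇒ C → A ⇒ B → A ⇒ C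
    ≈-equiv   : ∀ {A B} → IsEquivalence (_≈_ {A} {B})
    ∘-resp-≈  : ∀ {A B C} {f h : B ⇒ C} {g i : A ⇒ B} →
                f ≈ h → g ≈ i → f ∘ g ≈ h ∘ i
    assoc     : ∀ {A B C D} {f : A ⇒ B} {g : B ⇒ C} {h : C ⇒ D} →
                (h ∘ g) ∘ f ≈ h ∘ (g ∘ f)
    identityˡ : ∀ {A B} {f : A ⇒ B} → id ∘ f ≈ f
    identityʳ : ∀ {A B} {f : A ⇒ B} → f ∘ id ≈ f
    _⊗₀_ : Obj → Obj → Obj
    _⊗₁_ : ∀ {A B C D} → A ⇒ B → C ⇒ D → A ⊗₀ C ⇒ B ⊗₀ D
    ⊗-resp-≈ : ∀ {A B C D} {f f′ : A ⇒ B} {g g′ : C ⇒ D} →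
               f ≈ f′ → g ≈ g′ → f ⊗₁ g ≈ f′ ⊗₁ g′
    ⊗-id     : ∀ {A B} → id {A} ⊗₁ id {B} ≈ id
    ⊗-∘      : ∀ {A B C D E F} {f : B ⇒ C} {g : A ⇒ B} {h : E ⇒ F} {k : D ⇒ E} →
               (f ∘ g) ⊗₁ (h ∘ k) ≈ (f ⊗₁ h) ∘ (g ⊗₁ k)
    unit : Obj
    unitorˡ⇒ : ∀ {A} → unit ⊗₀ A ⇒ A
    unitorˡ⇐ : ∀ {A} → A ⇒ unit ⊗₀ A
    unitorˡ-isoˡ : ∀ {A} → unitorˡ⇐ ∘ unitorˡ⇒ ≈ id {unit ⊗₀ A}
    unitorˡ-isoʳ : ∀ {A} → unitorˡ⇒ ∘ unitorˡ⇐ ≈ id {A}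
    unitorˡ-natural : ∀ {A B} {f : A ⇒ B} → unitorˡ⇒ ∘ (id ⊗₁ f) ≈ f ∘ unitorˡ⇒
    unitorʳ⇒ : ∀ {A} → A ⊗₀ unit ⇒ A
    unitorʳ⇐ : ∀ {A} → A ⇒ A ⊗₀ unit
    unitorʳ-isoˡ : ∀ {A} → unitorʳ⇐ ∘ unitorʳ⇒ ≈ id {A ⊗₀ unit}
    unitorʳ-isoʳ : ∀ {A} → unitorʳ⇒ ∘ unitorʳ⇐ ≈ id {A}
    unitorʳ-natural : ∀ {A B} {f : A ⇒ B} → unitorʳ⇒ ∘ (f ⊗₁ id) ≈ f ∘ unitorʳ⇒
    associator⇒ : ∀ {A B C} → (A ⊗₀ B) ⊗₀ C ⇒ A ⊗₀ (B ⊗₀ C)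
    associator⇐ : ∀ {A B C} → A ⊗₀ (B ⊗₀ C) ⇒ (A ⊗₀ B) ⊗₀ C
    associator-isoˡ : ∀ {A B C} → associator⇐ ∘ associator⇒ ≈ id {(A ⊗₀ B) ⊗₀ C}
    associator-isoʳ : ∀ {A B C} → associator⇒ ∘ associator⇐ ≈ id {A ⊗₀ (B ⊗₀ C)}
    associator-natural : ∀ {A B C D E F} {f : A ⇒ D} {g : B ⇒ E} {h : C ⇒ F} →
      associator⇒ ∘ ((f ⊗₁ g) ⊗₁ h) ≈ (f ⊗₁ (g ⊗₁ h)) ∘ associator⇒
    triangle : ∀ {A B} →
      (id {A} ⊗₁ unitorˡ⇒ {B}) ∘ associator⇒ ≈ unitorʳ⇒ ⊗₁ id
    pentagon : ∀ {A B C D} →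
      (id {A} ⊗₁ associator⇒ {B} {C} {D}) ∘ (associator⇒ ∘ (associator⇒ ⊗₁ id))
        ≈ associator⇒ ∘ associator⇒
    braiding : ∀ {A B} → A ⊗₀ B ⇒ B ⊗₀ A
    braiding-natural : ∀ {A B C D} {f : A ⇒ B} {g : C ⇒ D} →
      braiding ∘ (f ⊗₁ g) ≈ (g ⊗₁ f) ∘ braiding
    commutative : ∀ {A B} → braiding {B} {A} ∘ braiding {A} {B} ≈ id
    hexagon : ∀ {A B C} →
      (id {B} ⊗₁ braiding {A} {C}) ∘ (associator⇒ ∘ (braiding ⊗₁ id))
        ≈ associator⇒ ∘ (braiding ∘ associator⇒)

  homSetoid : Obj → Obj → Setoid c ℓ
  homSetoid A B = record { Carrier = A ⇒ B ; _≈_ = _≈_ ; isEquivalence = ≈-equiv }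

-- Combs, as coends in (setoid-valued) sets

module Combs {o c ℓ : Level} (𝒞 : SymMonCat o c ℓ) where
  open SymMonCat 𝒞

  Fam : Set o
  Fam = ℕ → Obj

  const : Obj → Fam
  const A _ = A

  ⨂ : Fam → ℕ → Obj
  ⨂ Y zero    = Y 0
  ⨂ Y (suc n) = ⨂ Y n ⊗₀ Y (suc n)

  -- A chain of n+1 boxes  Aᵢ₋₁ ⊗ Xᵢ → Mᵢ ⊗ Yᵢ  (i = 0..n) with M₋₁ = A,
  -- Mₙ = B, and the internal wires M₀..Mₙ₋₁ recorded explicitly.
  data Chain : Fam → Fam → ℕ → Obj → Obj → Set (o ⊔ c) where
    last : ∀ {X Y A B} → A ⊗₀ X 0 ⇒ B ⊗₀ Y 0 → Chain X Y zero A B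
    cons : ∀ {X Y n A B} (M : Obj) → A ⊗₀ X 0 ⇒ M ⊗₀ Y 0 →
           Chain (X ∘′ suc) (Y ∘′ suc) n M B → Chain X Y (suc n) A B

  pre : ∀ {X Y n A A′ B} → A′ ⇒ A → Chain X Y n A B → Chain X Y n A′ B
  pre f (last a)     = last (a ∘ (f ⊗₁ id))
  pre f (cons M a c) = cons M (a ∘ (f ⊗₁ id)) c

  post : ∀ {X Y n A B B′} → B ⇒ B′ → Chain X Y n A B → Chain X Y n A B′
  post f (last a)     = last ((f ⊗₁ id) ∘ a)
  post f (cons M a c) = cons M a (post f c)

  -- generating relation of the coend over the internal wires
  -- (together with the hom-setoid equalities)
  data Step : ∀ {X Y n A B} → Rel (Chain X Y n A B) (o ⊔ c ⊔ ℓ) where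
    last≈ : ∀ {X Y A B} {a a′ : A ⊗₀ X 0 ⇒ B ⊗₀ Y 0} →
            a ≈ a′ → Step (last {X} {Y} a) (last a′)
    head≈ : ∀ {X Y n A B M} {a a′ : A ⊗₀ X 0 ⇒ M ⊗₀ Y 0}
              {r : Chain (X ∘′ suc) (Y ∘′ suc) n M B} →
            a ≈ a′ → Step {X} {Y} (cons M a r) (cons M a′ r)
    tail  : ∀ {X Y n A B M} {a : A ⊗₀ X 0 ⇒ M ⊗₀ Y 0}
              {r r′ : Chain (X ∘′ suc) (Y ∘′ suc) n M B} →
            Step r r′ → Step {X} {Y} (cons M a r) (cons M a r′)
    slide : ∀ {X Y n A B M M′} (f : M ⇒ M′) {a : A ⊗₀ X 0 ⇒ M ⊗₀ Y 0}
              {r : Chain (X ∘′ suc) (Y ∘′ suc) n M′ B} →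
            Step {X} {Y} (cons M a (pre f r)) (cons M′ ((f ⊗₁ id) ∘ a) r)

  -- Comb_n(X,Y) : M₋₁ = Mₙ = I, coend over M₀..Mₙ₋₁
  Comb : ℕ → Fam → Fam → Setoid (o ⊔ c) (o ⊔ c ⊔ ℓ)
  Comb n X Y = EqC.setoid (Step {X} {Y} {n} {unit} {unit})

  -- Comb⁺_n(X,Y) : M₋₁ = I, coend over M₀..Mₙ
  data Step⁺ {X Y : Fam} {n : ℕ} : Rel (Σ Obj (Chain X Y n unit)) (o ⊔ c ⊔ ℓ) where
    inner : ∀ {M} {r r′ : Chain X Y n unit M} → Step r r′ → Step⁺ (M , r) (M , r′)
    slideEnd : ∀ {M M′} (f : M ⇒ M′) {r : Chain X Y n unit M} →
               Step⁺ (M , r) (M′ , post f r)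

  Comb⁺ : ℕ → Fam → Fam → Setoid (o ⊔ c) (o ⊔ c ⊔ ℓ)
  Comb⁺ n X Y = EqC.setoid (Step⁺ {X} {Y} {n})

  -- forgetting the last component: Comb⁺_{n+1} → Comb⁺_n (on representatives)
  initChain : ∀ {X Y n A B} → Chain X Y (suc n) A B → Σ Obj (Chain X Y n A)
  initChain (cons M a (last b)) = M , last a
  initChain (cons M a (cons M′ b r)) with initChain (cons M′ b r)
  ... | E , d = E , cons M a d

  proj⁺ : ∀ {X Y} n → Setoid.Carrier (Comb⁺ (suc n) X Y) → Setoid.Carrier (Comb⁺ n X Y)
  proj⁺ n (M , r) = initChain r

  Lim : ∀ {a r} (S : ℕ → Setoid a r) →
        ((n : ℕ) → Setoid.Carrier (S (suc n)) → Setoid.Carrier (S n)) → Setoid (a ⊔ r) r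
  Lim S p = record
    { Carrier = Σ ((n : ℕ) → Setoid.Carrier (S n))
                  (λ x → (n : ℕ) → Setoid._≈_ (S n) (p n (x (suc n))) (x n))
    ; _≈_ = λ x y → (n : ℕ) → Setoid._≈_ (S n) (proj₁ x n) (proj₁ y n)
    ; isEquivalence = record
      { refl  = λ n → Setoid.refl (S n)
      ; sym   = λ e n → Setoid.sym (S n) (e n)
      ; trans = λ e f n → Setoid.trans (S n) (e n) (f n) } }

  Comb∞ : Fam → Fam → Setoid (o ⊔ c ⊔ ℓ) (o ⊔ c ⊔ ℓ)
  Comb∞ X Y = Lim (λ n → Comb⁺ n X Y) proj⁺

  data StepT (T : Obj) : Rel (Σ Obj (λ M → unit ⇒ T ⊗₀ M)) (o ⊔ c ⊔ ℓ) where
    hom≈ : ∀ {M} {g g′ : unit ⇒ T ⊗₀ M} → g ≈ g′ → StepT T (M , g) (M , g′)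
    slideT : ∀ {M M′} (f : M ⇒ M′) {g : unit ⇒ T ⊗₀ M} →
             StepT T (M , g) (M′ , (id ⊗₁ f) ∘ g)

  CoendT : Obj → Setoid (o ⊔ c) (o ⊔ c ⊔ ℓ)
  CoendT T = EqC.setoid (StepT T)

  transported : (Y : Fam) →
                (φ : (n : ℕ) → Inverse (Comb⁺ n (const unit) Y) (CoendT (⨂ Y n))) →
                (n : ℕ) → Setoid.Carrier (CoendT (⨂ Y (suc n))) →
                Setoid.Carrier (CoendT (⨂ Y n))
  transported Y φ n z = Inverse.to (φ n) (proj⁺ n (Inverse.from (φ (suc n)) z))

module Submission where

-- A box of a comb with
-- input I, incoming wire A and outgoing wires M, Yᵢ is a map A ⊗ I → M ⊗ Yᵢ;
-- straightening it (conjugating by the right unitor and the braiding) turns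
-- it into a map A → Yᵢ ⊗ M.  Plugging these maps into one another gives the
-- evaluation  eval : Chain I Y n A B → 𝒞(A, (⨂ᵢ Yᵢ) ⊗ B),  which respects the
-- coend relation (eval-step).  Conversely there is a universal chain, with
-- incoming wire (⨂ᵢ Yᵢ) ⊗ B, whose evaluation is the identity, and the key
-- lemma normal-form says that every chain c is coend-equivalent to the
-- universal chain precomposed with eval c: the evaluation of the tail is slid
-- through every internal wire.  Taking A = B = I gives the bijection for
-- Comb_n; taking A = I and B = M free gives the one for Comb⁺_n, where
-- sliding along the last wire matches the coend relation of ∫^M 𝒞(I, T ⊗ M).
-- Finally the projections Comb⁺_{n+1} → Comb⁺_n respect the coend relation
-- (forgetting the last box turns internal slides into slides at the open
-- end), and a levelwise family of bijections between towers of setoids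
-- induces a bijection of their limits, which yields the statement for Comb∞.

open import Defs
open import Level using (Level; _⊔_)
open import Data.Nat using (ℕ; zero; suc)
open import Data.Product using (Σ; _×_; _,_; proj₁; map₂)
open import Function using (_∘′_)
open import Function.Bundles using (Inverse)
import Function.Consequences.Setoid as FunctionSetoid
open import Relation.Binary using (Setoid; IsEquivalence; Rel)
open import Relation.Binary.Construct.Closure.Equivalence as EqC using (EqClosure)
import Relation.Binary.PropositionalEquality as PE
import Relation.Binary.Reasoning.Setoid as SetoidReasoning

inverse-of-roundtrips :
  ∀ {a₁ r₁ a₂ r₂} {S : Setoid a₁ r₁} {T : Setoid a₂ r₂}
  (to : Setoid.Carrier S → Setoid.Carrier T) (from : Setoid.Carrier T → Setoid.Carrier S) →
  (∀ {x y} → Setoid._≈_ S x y → Setoid._≈_ T (to x) (to y)) →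
  (∀ {x y} → Setoid._≈_ T x y → Setoid._≈_ S (from x) (from y)) →
  (∀ y → Setoid._≈_ T (to (from y)) y) →
  (∀ x → Setoid._≈_ S (from (to x)) x) → Inverse S T
inverse-of-roundtrips {S = S} {T} to from to-cong from-cong to∘from from∘to = record
  { to        = to
  ; from      = from
  ; to-cong   = to-cong
  ; from-cong = from-cong
  ; inverse   = strictlyInverseˡ⇒inverseˡ to-cong to∘from
              , strictlyInverseʳ⇒inverseʳ from-cong from∘to
  }
  where open FunctionSetoid S T

along : ∀ {a r} {T : Set a} {R : Rel T r} {x x′ y y′ : T} →
        x PE.≡ x′ → y PE.≡ y′ → EqClosure R x′ y′ → EqClosure R x y
along PE.refl PE.refl x′∼y′ = x′∼y′

module Development {o m ℓ : Level} (𝒞 : SymMonCat o m ℓ) where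
  open SymMonCat 𝒞
  open Combs 𝒞

  private
    module HomEquivalence {A B : Obj} = IsEquivalence (≈-equiv {A} {B})
    module HomReasoning {A B : Obj} = SetoidReasoning (homSetoid A B)
  open HomEquivalence using () renaming (refl to ≈refl; sym to ≈sym; trans to ≈trans)
  open HomReasoning

  infixr 4 _⟩∘⟨_
  _⟩∘⟨_ : ∀ {A B C} {f h : B ⇒ C} {g i : A ⇒ B} → f ≈ h → g ≈ i → f ∘ g ≈ h ∘ i
  _⟩∘⟨_ = ∘-resp-≈

  cancelˡ : ∀ {A B C} {g : B ⇒ C} {f : C ⇒ B} {k : A ⇒ B} → f ∘ g ≈ id → f ∘ (g ∘ k) ≈ k
  cancelˡ {g = g} {f} {k} f∘g≈id = begin
    f ∘ (g ∘ k) ≈⟨ ≈sym assoc ⟩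
    (f ∘ g) ∘ k ≈⟨ f∘g≈id ⟩∘⟨ ≈refl ⟩
    id ∘ k      ≈⟨ identityˡ ⟩
    k           ∎

  inverse-natural : ∀ {A B C D} {i : C ⇒ D} {i⁻¹ : D ⇒ C} {j : A ⇒ B} {j⁻¹ : B ⇒ A}
                      {F : A ⇒ C} {G : B ⇒ D} →
                    i⁻¹ ∘ i ≈ id → j ∘ j⁻¹ ≈ id → i ∘ F ≈ G ∘ j → i⁻¹ ∘ G ≈ F ∘ j⁻¹
  inverse-natural {i = i} {i⁻¹} {j} {j⁻¹} {F} {G} i⁻¹∘i≈id j∘j⁻¹≈id square = begin
    i⁻¹ ∘ G                 ≈⟨ ≈refl ⟩∘⟨ ≈sym (≈trans (≈refl ⟩∘⟨ j∘j⁻¹≈id) identityʳ) ⟩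
    i⁻¹ ∘ (G ∘ (j ∘ j⁻¹))   ≈⟨ ≈refl ⟩∘⟨ ≈sym assoc ⟩
    i⁻¹ ∘ ((G ∘ j) ∘ j⁻¹)   ≈⟨ ≈refl ⟩∘⟨ ≈sym square ⟩∘⟨ ≈refl ⟩
    i⁻¹ ∘ ((i ∘ F) ∘ j⁻¹)   ≈⟨ ≈refl ⟩∘⟨ assoc ⟩
    i⁻¹ ∘ (i ∘ (F ∘ j⁻¹))   ≈⟨ cancelˡ i⁻¹∘i≈id ⟩
    F ∘ j⁻¹                 ∎

  unitorʳ⇐-natural : ∀ {A B} {f : A ⇒ B} → unitorʳ⇐ ∘ f ≈ (f ⊗₁ id) ∘ unitorʳ⇐
  unitorʳ⇐-natural = inverse-natural unitorʳ-isoˡ unitorʳ-isoʳ unitorʳ-natural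

  associator⇐-natural : ∀ {A B C D E F} {f : A ⇒ D} {g : B ⇒ E} {h : C ⇒ F} →
    associator⇐ ∘ (f ⊗₁ (g ⊗₁ h)) ≈ ((f ⊗₁ g) ⊗₁ h) ∘ associator⇐
  associator⇐-natural = inverse-natural associator-isoˡ associator-isoʳ associator-natural

  ⊗id-∘ : ∀ {A B C D} {f : B ⇒ C} {g : A ⇒ B} → (f ⊗₁ id {D}) ∘ (g ⊗₁ id) ≈ (f ∘ g) ⊗₁ id
  ⊗id-∘ = ≈trans (≈sym ⊗-∘) (⊗-resp-≈ ≈refl identityˡ)

  id⊗-∘ : ∀ {A B C D} {f : B ⇒ C} {g : A ⇒ B} → (id {D} ⊗₁ f) ∘ (id ⊗₁ g) ≈ id ⊗₁ (f ∘ g)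
  id⊗-∘ = ≈trans (≈sym ⊗-∘) (⊗-resp-≈ identityˡ ≈refl)

  ⊗-interchange : ∀ {A B C D} {f : A ⇒ B} {g : C ⇒ D} →
                  (f ⊗₁ id) ∘ (id ⊗₁ g) ≈ (id ⊗₁ g) ∘ (f ⊗₁ id)
  ⊗-interchange = ≈trans (≈sym ⊗-∘)
    (≈trans (⊗-resp-≈ (≈trans identityʳ (≈sym identityˡ)) (≈trans identityˡ (≈sym identityʳ))) ⊗-∘)

  record Iso (A B : Obj) : Set (m ⊔ ℓ) where
    field
      fwd     : A ⇒ B
      bwd     : B ⇒ A
      bwd∘fwd : bwd ∘ fwd ≈ id
      fwd∘bwd : fwd ∘ bwd ≈ id
  open Iso

  idᵢ : ∀ {A} → Iso A A
  idᵢ = record { fwd = id ; bwd = id ; bwd∘fwd = identityˡ ; fwd∘bwd = identityˡ }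

  _∘ᵢ_ : ∀ {A B C} → Iso B C → Iso A B → Iso A C
  j ∘ᵢ i = record
    { fwd     = fwd j ∘ fwd i
    ; bwd     = bwd i ∘ bwd j
    ; bwd∘fwd = ≈trans assoc (≈trans (≈refl ⟩∘⟨ cancelˡ (bwd∘fwd j)) (bwd∘fwd i))
    ; fwd∘bwd = ≈trans assoc (≈trans (≈refl ⟩∘⟨ cancelˡ (fwd∘bwd i)) (fwd∘bwd j))
    }

  _⊗ᵢ-id : ∀ {A B C} → Iso A B → Iso (A ⊗₀ C) (B ⊗₀ C)
  i ⊗ᵢ-id = record
    { fwd     = fwd i ⊗₁ id
    ; bwd     = bwd i ⊗₁ id
    ; bwd∘fwd = ≈trans ⊗id-∘ (≈trans (⊗-resp-≈ (bwd∘fwd i) ≈refl) ⊗-id)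
    ; fwd∘bwd = ≈trans ⊗id-∘ (≈trans (⊗-resp-≈ (fwd∘bwd i) ≈refl) ⊗-id)
    }

  associatorᵢ : ∀ {A B C} → Iso ((A ⊗₀ B) ⊗₀ C) (A ⊗₀ (B ⊗₀ C))
  associatorᵢ = record
    { fwd = associator⇒ ; bwd = associator⇐
    ; bwd∘fwd = associator-isoˡ ; fwd∘bwd = associator-isoʳ }

  split : ∀ (Y : Fam) n → Iso (⨂ Y (suc n)) (Y 0 ⊗₀ ⨂ (Y ∘′ suc) n)
  peel  : ∀ (Y : Fam) n B → Iso (⨂ Y (suc n) ⊗₀ B) (Y 0 ⊗₀ (⨂ (Y ∘′ suc) n ⊗₀ B))

  split Y zero    = idᵢ
  split Y (suc n) = peel Y n (Y (suc (suc n)))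

  peel Y n B = associatorᵢ ∘ᵢ (split Y n ⊗ᵢ-id)

  unpeel-natural : ∀ (Y : Fam) n {B B′} {f : B ⇒ B′} →
    bwd (peel Y n B′) ∘ (id ⊗₁ (id ⊗₁ f)) ≈ (id ⊗₁ f) ∘ bwd (peel Y n B)
  unpeel-natural Y n {f = f} = begin
    ((unsplit ⊗₁ id) ∘ associator⇐) ∘ (id ⊗₁ (id ⊗₁ f))  ≈⟨ assoc ⟩
    (unsplit ⊗₁ id) ∘ (associator⇐ ∘ (id ⊗₁ (id ⊗₁ f)))  ≈⟨ ≈refl ⟩∘⟨ associator⇐-natural ⟩
    (unsplit ⊗₁ id) ∘ (((id ⊗₁ id) ⊗₁ f) ∘ associator⇐)  ≈⟨ ≈refl ⟩∘⟨ ⊗-resp-≈ ⊗-id ≈refl ⟩∘⟨ ≈refl ⟩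
    (unsplit ⊗₁ id) ∘ ((id ⊗₁ f) ∘ associator⇐)          ≈⟨ ≈sym assoc ⟩
    ((unsplit ⊗₁ id) ∘ (id ⊗₁ f)) ∘ associator⇐          ≈⟨ ⊗-interchange ⟩∘⟨ ≈refl ⟩
    ((id ⊗₁ f) ∘ (unsplit ⊗₁ id)) ∘ associator⇐          ≈⟨ assoc ⟩
    (id ⊗₁ f) ∘ ((unsplit ⊗₁ id) ∘ associator⇐)          ∎
    where
    unsplit : Y 0 ⊗₀ ⨂ (Y ∘′ suc) n ⇒ ⨂ Y (suc n)
    unsplit = bwd (split Y n)

  straighten : ∀ {A M N} → A ⊗₀ unit ⇒ M ⊗₀ N → A ⇒ N ⊗₀ M
  straighten a = braiding ∘ (a ∘ unitorʳ⇐)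

  bend : ∀ {A M N} → A ⇒ N ⊗₀ M → A ⊗₀ unit ⇒ M ⊗₀ N
  bend h = braiding ∘ (h ∘ unitorʳ⇒)

  conjugate-twice : ∀ {X X′ P Q} {x : X ⇒ P ⊗₀ Q} {k : X′ ⇒ X} {k′ : X ⇒ X′} →
                    k ∘ k′ ≈ id → braiding ∘ ((braiding ∘ (x ∘ k)) ∘ k′) ≈ x
  conjugate-twice {x = x} {k} {k′} k∘k′≈id = begin
    braiding ∘ ((braiding ∘ (x ∘ k)) ∘ k′)   ≈⟨ ≈refl ⟩∘⟨ assoc ⟩
    braiding ∘ (braiding ∘ ((x ∘ k) ∘ k′))   ≈⟨ cancelˡ commutative ⟩
    (x ∘ k) ∘ k′                             ≈⟨ assoc ⟩
    x ∘ (k ∘ k′)                             ≈⟨ ≈refl ⟩∘⟨ k∘k′≈id ⟩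
    x ∘ id                                   ≈⟨ identityʳ ⟩
    x                                        ∎

  bend-straighten : ∀ {A M N} (a : A ⊗₀ unit ⇒ M ⊗₀ N) → bend (straighten a) ≈ a
  bend-straighten a = conjugate-twice unitorʳ-isoˡ

  straighten-bend : ∀ {A M N} (h : A ⇒ N ⊗₀ M) → straighten (bend h) ≈ h
  straighten-bend h = conjugate-twice unitorʳ-isoʳ

  straighten-cong : ∀ {A M N} {a a′ : A ⊗₀ unit ⇒ M ⊗₀ N} → a ≈ a′ → straighten a ≈ straighten a′
  straighten-cong a≈a′ = ≈refl ⟩∘⟨ a≈a′ ⟩∘⟨ ≈refl

  bend-cong : ∀ {A M N} {h h′ : A ⇒ N ⊗₀ M} → h ≈ h′ → bend h ≈ bend h′
  bend-cong h≈h′ = ≈refl ⟩∘⟨ h≈h′ ⟩∘⟨ ≈refl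

  straighten-pre : ∀ {A A′ M N} (a : A ⊗₀ unit ⇒ M ⊗₀ N) (f : A′ ⇒ A) →
                   straighten (a ∘ (f ⊗₁ id)) ≈ straighten a ∘ f
  straighten-pre a f = begin
    braiding ∘ ((a ∘ (f ⊗₁ id)) ∘ unitorʳ⇐)   ≈⟨ ≈refl ⟩∘⟨ assoc ⟩
    braiding ∘ (a ∘ ((f ⊗₁ id) ∘ unitorʳ⇐))   ≈⟨ ≈refl ⟩∘⟨ ≈refl ⟩∘⟨ ≈sym unitorʳ⇐-natural ⟩
    braiding ∘ (a ∘ (unitorʳ⇐ ∘ f))           ≈⟨ ≈refl ⟩∘⟨ ≈sym assoc ⟩
    braiding ∘ ((a ∘ unitorʳ⇐) ∘ f)           ≈⟨ ≈sym assoc ⟩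
    (braiding ∘ (a ∘ unitorʳ⇐)) ∘ f           ∎

  straighten-post : ∀ {A M M′ N} (a : A ⊗₀ unit ⇒ M ⊗₀ N) (f : M ⇒ M′) →
                    straighten ((f ⊗₁ id) ∘ a) ≈ (id ⊗₁ f) ∘ straighten a
  straighten-post a f = begin
    braiding ∘ (((f ⊗₁ id) ∘ a) ∘ unitorʳ⇐)   ≈⟨ ≈refl ⟩∘⟨ assoc ⟩
    braiding ∘ ((f ⊗₁ id) ∘ (a ∘ unitorʳ⇐))   ≈⟨ ≈sym assoc ⟩
    (braiding ∘ (f ⊗₁ id)) ∘ (a ∘ unitorʳ⇐)   ≈⟨ braiding-natural ⟩∘⟨ ≈refl ⟩
    ((id ⊗₁ f) ∘ braiding) ∘ (a ∘ unitorʳ⇐)   ≈⟨ assoc ⟩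
    (id ⊗₁ f) ∘ (braiding ∘ (a ∘ unitorʳ⇐))   ∎

  bend-pre : ∀ {A A′ M N} (h : A ⇒ N ⊗₀ M) (f : A′ ⇒ A) → bend h ∘ (f ⊗₁ id) ≈ bend (h ∘ f)
  bend-pre h f = begin
    (braiding ∘ (h ∘ unitorʳ⇒)) ∘ (f ⊗₁ id)   ≈⟨ assoc ⟩
    braiding ∘ ((h ∘ unitorʳ⇒) ∘ (f ⊗₁ id))   ≈⟨ ≈refl ⟩∘⟨ assoc ⟩
    braiding ∘ (h ∘ (unitorʳ⇒ ∘ (f ⊗₁ id)))   ≈⟨ ≈refl ⟩∘⟨ ≈refl ⟩∘⟨ unitorʳ-natural ⟩
    braiding ∘ (h ∘ (f ∘ unitorʳ⇒))           ≈⟨ ≈refl ⟩∘⟨ ≈sym assoc ⟩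
    braiding ∘ ((h ∘ f) ∘ unitorʳ⇒)           ∎

  bend-post : ∀ {A M N N′} (h : A ⇒ N ⊗₀ M) (e : M ⇒ N′) →
              bend ((id ⊗₁ e) ∘ h) ≈ (e ⊗₁ id) ∘ bend h
  bend-post h e = begin
    braiding ∘ (((id ⊗₁ e) ∘ h) ∘ unitorʳ⇒)   ≈⟨ ≈refl ⟩∘⟨ assoc ⟩
    braiding ∘ ((id ⊗₁ e) ∘ (h ∘ unitorʳ⇒))   ≈⟨ ≈sym assoc ⟩
    (braiding ∘ (id ⊗₁ e)) ∘ (h ∘ unitorʳ⇒)   ≈⟨ braiding-natural ⟩∘⟨ ≈refl ⟩
    ((e ⊗₁ id) ∘ braiding) ∘ (h ∘ unitorʳ⇒)   ≈⟨ assoc ⟩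
    (e ⊗₁ id) ∘ (braiding ∘ (h ∘ unitorʳ⇒))   ∎

  -- Plugging the evaluation e of the remaining boxes into the carried wire M,
  -- next to the output Y₀ of the first box.
  attach : ∀ (Y : Fam) n {M B} → M ⇒ ⨂ (Y ∘′ suc) n ⊗₀ B → Y 0 ⊗₀ M ⇒ ⨂ Y (suc n) ⊗₀ B
  attach Y n {B = B} e = bwd (peel Y n B) ∘ (id ⊗₁ e)

  attach-cong : ∀ (Y : Fam) n {M B} {e e′ : M ⇒ ⨂ (Y ∘′ suc) n ⊗₀ B} →
                e ≈ e′ → attach Y n e ≈ attach Y n e′
  attach-cong Y n e≈e′ = ≈refl ⟩∘⟨ ⊗-resp-≈ ≈refl e≈e′

  attach-pre : ∀ (Y : Fam) n {M M′ B} (e : M′ ⇒ ⨂ (Y ∘′ suc) n ⊗₀ B) (f : M ⇒ M′) →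
               attach Y n (e ∘ f) ≈ attach Y n e ∘ (id ⊗₁ f)
  attach-pre Y n e f = ≈trans (≈refl ⟩∘⟨ ≈sym id⊗-∘) (≈sym assoc)

  attach-post : ∀ (Y : Fam) n {M B B′} (e : M ⇒ ⨂ (Y ∘′ suc) n ⊗₀ B) (f : B ⇒ B′) →
                attach Y n ((id ⊗₁ f) ∘ e) ≈ (id ⊗₁ f) ∘ attach Y n e
  attach-post Y n {B = B} {B′} e f = begin
    unpeel′ ∘ (id ⊗₁ ((id ⊗₁ f) ∘ e))           ≈⟨ ≈refl ⟩∘⟨ ≈sym id⊗-∘ ⟩
    unpeel′ ∘ ((id ⊗₁ (id ⊗₁ f)) ∘ (id ⊗₁ e))   ≈⟨ ≈sym assoc ⟩
    (unpeel′ ∘ (id ⊗₁ (id ⊗₁ f))) ∘ (id ⊗₁ e)   ≈⟨ unpeel-natural Y n ⟩∘⟨ ≈refl ⟩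
    ((id ⊗₁ f) ∘ unpeel) ∘ (id ⊗₁ e)            ≈⟨ assoc ⟩
    (id ⊗₁ f) ∘ (unpeel ∘ (id ⊗₁ e))            ∎
    where
    unpeel : Y 0 ⊗₀ (⨂ (Y ∘′ suc) n ⊗₀ B) ⇒ ⨂ Y (suc n) ⊗₀ B
    unpeel = bwd (peel Y n B)
    unpeel′ : Y 0 ⊗₀ (⨂ (Y ∘′ suc) n ⊗₀ B′) ⇒ ⨂ Y (suc n) ⊗₀ B′
    unpeel′ = bwd (peel Y n B′)

  unitFam : Fam
  unitFam = const unit

  eval : ∀ {Y n A B} → Chain unitFam Y n A B → A ⇒ ⨂ Y n ⊗₀ B
  eval (last a)                    = straighten a
  eval {Y} {suc n} (cons M a rest) = attach Y n (eval rest) ∘ straighten a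

  eval-pre : ∀ {Y n A A′ B} (f : A′ ⇒ A) (c : Chain unitFam Y n A B) → eval (pre f c) ≈ eval c ∘ f
  eval-pre f (last a)        = straighten-pre a f
  eval-pre f (cons M a rest) = ≈trans (≈refl ⟩∘⟨ straighten-pre a f) (≈sym assoc)

  eval-post : ∀ {Y n A B B′} (f : B ⇒ B′) (c : Chain unitFam Y n A B) →
              eval (post f c) ≈ (id ⊗₁ f) ∘ eval c
  eval-post f (last a) = straighten-post a f
  eval-post {Y} {suc n} f (cons M a rest) = begin
    attach Y n (eval (post f rest)) ∘ straighten a       ≈⟨ attach-cong Y n (eval-post f rest) ⟩∘⟨ ≈refl ⟩
    attach Y n ((id ⊗₁ f) ∘ eval rest) ∘ straighten a    ≈⟨ attach-post Y n (eval rest) f ⟩∘⟨ ≈refl ⟩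
    ((id ⊗₁ f) ∘ attach Y n (eval rest)) ∘ straighten a  ≈⟨ assoc ⟩
    (id ⊗₁ f) ∘ (attach Y n (eval rest) ∘ straighten a)  ∎

  eval-step : ∀ {Y n A B} {c c′ : Chain unitFam Y n A B} → Step c c′ → eval c ≈ eval c′
  eval-step (last≈ a≈a′) = straighten-cong a≈a′
  eval-step (head≈ a≈a′) = ≈refl ⟩∘⟨ straighten-cong a≈a′
  eval-step {Y} {suc n} (tail s) = attach-cong Y n (eval-step s) ⟩∘⟨ ≈refl
  eval-step {Y} {suc n} (slide f {a} {rest}) = begin
    attach Y n (eval (pre f rest)) ∘ straighten a        ≈⟨ attach-cong Y n (eval-pre f rest) ⟩∘⟨ ≈refl ⟩
    attach Y n (eval rest ∘ f) ∘ straighten a            ≈⟨ attach-pre Y n (eval rest) f ⟩∘⟨ ≈refl ⟩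
    (attach Y n (eval rest) ∘ (id ⊗₁ f)) ∘ straighten a  ≈⟨ assoc ⟩
    attach Y n (eval rest) ∘ ((id ⊗₁ f) ∘ straighten a)  ≈⟨ ≈refl ⟩∘⟨ ≈sym (straighten-post a f) ⟩
    attach Y n (eval rest) ∘ straighten ((f ⊗₁ id) ∘ a)  ∎

  universal : ∀ (Y : Fam) n B → Chain unitFam Y n (⨂ Y n ⊗₀ B) B
  universal Y zero    B = last (bend id)
  universal Y (suc n) B = cons _ (bend (fwd (peel Y n B))) (universal (Y ∘′ suc) n B)

  eval-universal : ∀ (Y : Fam) n B → eval (universal Y n B) ≈ id
  eval-universal Y zero    B = straighten-bend id
  eval-universal Y (suc n) B = begin
    attach Y n (eval (universal (Y ∘′ suc) n B)) ∘ straighten (bend (fwd (peel Y n B)))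
      ≈⟨ attach-cong Y n (eval-universal (Y ∘′ suc) n B) ⟩∘⟨ straighten-bend _ ⟩
    (bwd (peel Y n B) ∘ (id ⊗₁ id)) ∘ fwd (peel Y n B)
      ≈⟨ ≈trans (≈refl ⟩∘⟨ ⊗-id) identityʳ ⟩∘⟨ ≈refl ⟩
    bwd (peel Y n B) ∘ fwd (peel Y n B)
      ≈⟨ bwd∘fwd (peel Y n B) ⟩
    id ∎

  universal-head : ∀ {Y : Fam} {n A B M} (a : A ⊗₀ unit ⇒ M ⊗₀ Y 0)
                     (rest : Chain unitFam (Y ∘′ suc) n M B) →
                   bend (fwd (peel Y n B)) ∘ (eval {Y} {suc n} (cons M a rest) ⊗₁ id)
                     ≈ (eval rest ⊗₁ id) ∘ a
  universal-head {Y} {n} {B = B} a rest = begin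
    bend peelₙ ∘ (((unpeelₙ ∘ (id ⊗₁ eval rest)) ∘ straighten a) ⊗₁ id)
      ≈⟨ bend-pre peelₙ _ ⟩
    bend (peelₙ ∘ ((unpeelₙ ∘ (id ⊗₁ eval rest)) ∘ straighten a))
      ≈⟨ bend-cong (≈trans (≈refl ⟩∘⟨ assoc) (cancelˡ (fwd∘bwd (peel Y n B)))) ⟩
    bend ((id ⊗₁ eval rest) ∘ straighten a)
      ≈⟨ bend-post (straighten a) (eval rest) ⟩
    (eval rest ⊗₁ id) ∘ bend (straighten a)
      ≈⟨ ≈refl ⟩∘⟨ bend-straighten a ⟩
    (eval rest ⊗₁ id) ∘ a ∎
    where
    peelₙ : ⨂ Y (suc n) ⊗₀ B ⇒ Y 0 ⊗₀ (⨂ (Y ∘′ suc) n ⊗₀ B)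
    peelₙ = fwd (peel Y n B)
    unpeelₙ : Y 0 ⊗₀ (⨂ (Y ∘′ suc) n ⊗₀ B) ⇒ ⨂ Y (suc n) ⊗₀ B
    unpeelₙ = bwd (peel Y n B)

  pre-cong : ∀ {X Y n A A′ B} {f f′ : A′ ⇒ A} (c : Chain X Y n A B) → f ≈ f′ → Step (pre f c) (pre f′ c)
  pre-cong (last a)        f≈f′ = last≈ (≈refl ⟩∘⟨ ⊗-resp-≈ f≈f′ ≈refl)
  pre-cong (cons M a rest) f≈f′ = head≈ (≈refl ⟩∘⟨ ⊗-resp-≈ f≈f′ ≈refl)

  -- Normal form: every chain is coend-equivalent to the universal chain
  -- precomposed with its evaluation.  Inductively, slide eval rest from the
  -- first wire into the tail.
  normal-form : ∀ {Y n A B} (c : Chain unitFam Y n A B) →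
                EqClosure Step (pre (eval c) (universal Y n B)) c
  normal-form (last a) = EqC.return (last≈ (begin
    bend id ∘ (straighten a ⊗₁ id)  ≈⟨ bend-pre id (straighten a) ⟩
    bend (id ∘ straighten a)        ≈⟨ bend-cong identityˡ ⟩
    bend (straighten a)             ≈⟨ bend-straighten a ⟩
    a                               ∎))
  normal-form {Y} {suc n} (cons M a rest) =
    EqC.transitive Step (EqC.return (head≈ (universal-head a rest)))
      (EqC.transitive Step (EqC.symmetric Step (EqC.return (slide (eval rest))))
        (EqC.gmap (cons M a) tail (normal-form rest)))

  comb-bijection : ∀ (Y : Fam) n → Inverse (Comb n unitFam Y) (homSetoid unit (⨂ Y n))
  comb-bijection Y n = inverse-of-roundtrips to from
    (EqC.gfold ≈-equiv to (λ s → ≈refl ⟩∘⟨ eval-step s))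
    (λ h≈h′ → EqC.return (pre-cong (universal Y n unit) (≈refl ⟩∘⟨ h≈h′)))
    to∘from from∘to
    where
    to : Chain unitFam Y n unit unit → unit ⇒ ⨂ Y n
    to c = unitorʳ⇒ ∘ eval c
    from : unit ⇒ ⨂ Y n → Chain unitFam Y n unit unit
    from h = pre (unitorʳ⇐ ∘ h) (universal Y n unit)
    to∘from : ∀ h → to (from h) ≈ h
    to∘from h = begin
      unitorʳ⇒ ∘ eval (pre (unitorʳ⇐ ∘ h) (universal Y n unit))
        ≈⟨ ≈refl ⟩∘⟨ eval-pre _ (universal Y n unit) ⟩
      unitorʳ⇒ ∘ (eval (universal Y n unit) ∘ (unitorʳ⇐ ∘ h))
        ≈⟨ ≈refl ⟩∘⟨ ≈trans (eval-universal Y n unit ⟩∘⟨ ≈refl) identityˡ ⟩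
      unitorʳ⇒ ∘ (unitorʳ⇐ ∘ h)
        ≈⟨ cancelˡ unitorʳ-isoʳ ⟩
      h ∎
    from∘to : ∀ c → EqClosure Step (from (to c)) c
    from∘to c = EqC.transitive Step
      (EqC.return (pre-cong (universal Y n unit) (cancelˡ unitorʳ-isoˡ))) (normal-form c)

  -- Comb⁺_n(I, Y) ≅ ∫^M 𝒞(I, (⨂ᵢ Yᵢ) ⊗ M): sliding along the last wire of a
  -- chain matches the coend relation of the right-hand side.
  comb⁺-bijection : ∀ (Y : Fam) n → Inverse (Comb⁺ n unitFam Y) (CoendT (⨂ Y n))
  comb⁺-bijection Y n = inverse-of-roundtrips to from
    (EqC.gfold (EqC.isEquivalence _) to to-step)
    (EqC.gfold (EqC.isEquivalence _) from from-step)
    to∘from from∘to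
    where
    T : Obj
    T = ⨂ Y n
    to : Σ Obj (Chain unitFam Y n unit) → Σ Obj (λ M → unit ⇒ T ⊗₀ M)
    to (M , c) = M , eval c
    from : Σ Obj (λ M → unit ⇒ T ⊗₀ M) → Σ Obj (Chain unitFam Y n unit)
    from (M , g) = M , pre g (universal Y n M)
    inner* : ∀ {M} {c c′ : Chain unitFam Y n unit M} →
             EqClosure Step c c′ → EqClosure Step⁺ (M , c) (M , c′)
    inner* = EqC.gmap (_ ,_) inner
    eval-universal-pre : ∀ {M} (g : unit ⇒ T ⊗₀ M) → eval (pre g (universal Y n M)) ≈ g
    eval-universal-pre {M} g =
      ≈trans (eval-pre g (universal Y n M)) (≈trans (eval-universal Y n M ⟩∘⟨ ≈refl) identityˡ)
    to-step : ∀ {x y} → Step⁺ x y → EqClosure (StepT T) (to x) (to y)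
    to-step (inner s)        = EqC.return (hom≈ (eval-step s))
    to-step (slideEnd f {c}) = EqC.transitive (StepT T) (EqC.return (slideT f))
                                 (EqC.return (hom≈ (≈sym (eval-post f c))))
    from-step : ∀ {x y} → StepT T x y → EqClosure Step⁺ (from x) (from y)
    from-step (hom≈ {M} g≈g′) = EqC.return (inner (pre-cong (universal Y n M) g≈g′))
    from-step (slideT {M} {M′} f {g}) =
      EqC.transitive Step⁺ (EqC.return (slideEnd f))
        (EqC.transitive Step⁺ (inner* (EqC.symmetric Step (normal-form (post f chain))))
          (EqC.return (inner (pre-cong (universal Y n M′) (begin
            eval (post f chain)       ≈⟨ eval-post f chain ⟩
            (id ⊗₁ f) ∘ eval chain    ≈⟨ ≈refl ⟩∘⟨ eval-universal-pre g ⟩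
            (id ⊗₁ f) ∘ g             ∎)))))
      where
      chain : Chain unitFam Y n unit M
      chain = pre g (universal Y n M)
    to∘from : ∀ y → EqClosure (StepT T) (to (from y)) y
    to∘from (M , g) = EqC.return (hom≈ (eval-universal-pre g))
    from∘to : ∀ x → EqClosure Step⁺ (from (to x)) x
    from∘to (M , c) = inner* (normal-form c)

  data OpenStep {X Y : Fam} {n : ℕ} {A : Obj} : Rel (Σ Obj (Chain X Y n A)) (o ⊔ m ⊔ ℓ) where
    innerO    : ∀ {M} {r r′ : Chain X Y n A M} → Step r r′ → OpenStep (M , r) (M , r′)
    slideEndO : ∀ {M M′} (f : M ⇒ M′) {r : Chain X Y n A M} → OpenStep (M , r) (M′ , post f r)

  toStep⁺ : ∀ {X Y n} {x y : Σ Obj (Chain X Y n unit)} → OpenStep x y → Step⁺ x y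
  toStep⁺ (innerO s)    = inner s
  toStep⁺ (slideEndO f) = slideEnd f

  prepend : ∀ {X Y n A M} → A ⊗₀ X 0 ⇒ M ⊗₀ Y 0 →
            Σ Obj (Chain (X ∘′ suc) (Y ∘′ suc) n M) → Σ Obj (Chain X Y (suc n) A)
  prepend a (E , d) = E , cons _ a d

  prepend-step : ∀ {X Y n A M} (a : A ⊗₀ X 0 ⇒ M ⊗₀ Y 0)
                   {x y : Σ Obj (Chain (X ∘′ suc) (Y ∘′ suc) n M)} →
                 OpenStep x y → OpenStep {X} {Y} (prepend a x) (prepend a y)
  prepend-step a (innerO s)    = innerO (tail s)
  prepend-step a (slideEndO f) = slideEndO f

  initChain-cons : ∀ {X Y n A B M} (a : A ⊗₀ X 0 ⇒ M ⊗₀ Y 0)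
                     (r : Chain (X ∘′ suc) (Y ∘′ suc) (suc n) M B) →
                   initChain (cons {X} {Y} M a r) PE.≡ prepend a (initChain r)
  initChain-cons {X} {Y} a (cons M′ b r) with initChain {X ∘′ suc} {Y ∘′ suc} (cons M′ b r)
  ... | E , d = PE.refl

  initChain-pre : ∀ {X Y n A A′ B} (f : A′ ⇒ A) (r : Chain X Y (suc n) A B) →
                  initChain (pre f r) PE.≡ map₂ (pre f) (initChain r)
  initChain-pre f (cons M a (last b))      = PE.refl
  initChain-pre f (cons M a (cons M′ b r)) =
    PE.trans (initChain-cons _ (cons M′ b r))
             (PE.sym (PE.cong (map₂ (pre f)) (initChain-cons a (cons M′ b r))))

  initChain-post : ∀ {X Y n A B B′} (f : B ⇒ B′) (r : Chain X Y (suc n) A B) →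
                   initChain (post f r) PE.≡ initChain r
  initChain-post f (cons M a (last b))      = PE.refl
  initChain-post f (cons M a (cons M′ b r)) =
    PE.trans (initChain-cons a (post f (cons M′ b r)))
      (PE.trans (PE.cong (prepend a) (initChain-post f (cons M′ b r)))
                (PE.sym (initChain-cons a (cons M′ b r))))

  -- Forgetting the last box sends internal coend steps to open coend steps:
  -- sliding through the last internal wire becomes sliding through the open end.
  initChain-step : ∀ {X Y n A B} {r r′ : Chain X Y (suc n) A B} → Step r r′ →
                   EqClosure OpenStep (initChain r) (initChain r′)
  initChain-step (head≈ {r = last b} a≈a′) = EqC.return (innerO (last≈ a≈a′))
  initChain-step (head≈ {a = a} {a′} {r = cons M′ b r} a≈a′) =
    along (initChain-cons a (cons M′ b r)) (initChain-cons a′ (cons M′ b r))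
      (EqC.return (innerO (head≈ a≈a′)))
  initChain-step (tail {r = last _} {r′ = last _} _) = EqC.reflexive _
  initChain-step (tail {a = a} {r = cons M₁ b₁ r₁} {r′ = cons M₂ b₂ r₂} s) =
    along (initChain-cons a (cons M₁ b₁ r₁)) (initChain-cons a (cons M₂ b₂ r₂))
      (EqC.gmap (prepend a) (prepend-step a) (initChain-step s))
  initChain-step (slide f {a} {r = last b}) = EqC.return (slideEndO f)
  initChain-step (slide f {a} {r = cons M″ b r}) =
    along (PE.trans (initChain-cons a (pre f (cons M″ b r)))
                    (PE.cong (prepend a) (initChain-pre f (cons M″ b r))))
          (initChain-cons ((f ⊗₁ id) ∘ a) (cons M″ b r))
          (EqC.return (innerO (slide f)))

  proj⁺-cong : ∀ {X Y} n {x y : Σ Obj (Chain X Y (suc n) unit)} →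
               EqClosure Step⁺ x y → EqClosure Step⁺ (proj⁺ n x) (proj⁺ n y)
  proj⁺-cong n = EqC.gfold (EqC.isEquivalence _) (proj⁺ n) step
    where
    step : ∀ {x y} → Step⁺ x y → EqClosure Step⁺ (proj⁺ n x) (proj⁺ n y)
    step (inner s)        = EqC.map toStep⁺ (initChain-step s)
    step (slideEnd f {r}) = along PE.refl (initChain-post f r) (EqC.reflexive _)

  lim-inverse :
    ∀ {a r a′ r′} (S : ℕ → Setoid a r) (T : ℕ → Setoid a′ r′)
      (p : (n : ℕ) → Setoid.Carrier (S (suc n)) → Setoid.Carrier (S n)) →
    (∀ n {x y} → Setoid._≈_ (S (suc n)) x y → Setoid._≈_ (S n) (p n x) (p n y)) →
    (φ : (n : ℕ) → Inverse (S n) (T n)) →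
    Σ (Inverse (Lim S p) (Lim T (λ n z → Inverse.to (φ n) (p n (Inverse.from (φ (suc n)) z)))))
      (λ ψ → (x : Setoid.Carrier (Lim S p)) (n : ℕ) →
             Setoid._≈_ (T n) (proj₁ (Inverse.to ψ x) n) (Inverse.to (φ n) (proj₁ x n)))
  lim-inverse {a′ = a′} {r′ = r′} S T p p-cong φ =
    inverse-of-roundtrips {S = Lim S p} {T = LimT} to from
      (λ x≈y n → φ.to-cong n (x≈y n)) (λ x≈y n → φ.from-cong n (x≈y n))
      (λ y n → φ.strictlyInverseˡ n (proj₁ y n)) (λ x n → φ.strictlyInverseʳ n (proj₁ x n))
    , λ x n → Setoid.refl (T n)
    where
    module φ n = Inverse (φ n)
    module S n = Setoid (S n)
    module T n = Setoid (T n)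
    LimT : Setoid (a′ ⊔ r′) r′
    LimT = Lim T (λ n z → φ.to n (p n (φ.from (suc n) z)))
    to : Setoid.Carrier (Lim S p) → Setoid.Carrier LimT
    to (x , x-compatible) = (λ n → φ.to n (x n)) , λ n →
      T.trans n (φ.to-cong n (p-cong n (φ.strictlyInverseʳ (suc n) (x (suc n)))))
                (φ.to-cong n (x-compatible n))
    from : Setoid.Carrier LimT → Setoid.Carrier (Lim S p)
    from (y , y-compatible) = (λ n → φ.from n (y n)) , λ n →
      S.sym n (S.trans n (φ.from-cong n (T.sym n (y-compatible n)))
                         (φ.strictlyInverseʳ n (p n (φ.from (suc n) (y (suc n))))))

mainTheorem2 : ∀ {o c ℓ : Level} (𝒞 : SymMonCat o c ℓ) (Y : Combs.Fam 𝒞) →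
    ((n : ℕ) → Inverse (Combs.Comb 𝒞 n (Combs.const 𝒞 (SymMonCat.unit 𝒞)) Y)
                       (SymMonCat.homSetoid 𝒞 (SymMonCat.unit 𝒞) (Combs.⨂ 𝒞 Y n)))
  × Σ ((n : ℕ) → Inverse (Combs.Comb⁺ 𝒞 n (Combs.const 𝒞 (SymMonCat.unit 𝒞)) Y)
                         (Combs.CoendT 𝒞 (Combs.⨂ 𝒞 Y n)))
      (λ φ → Σ (Inverse (Combs.Comb∞ 𝒞 (Combs.const 𝒞 (SymMonCat.unit 𝒞)) Y)
                        (Combs.Lim 𝒞 (λ n → Combs.CoendT 𝒞 (Combs.⨂ 𝒞 Y n))
                                     (Combs.transported 𝒞 Y φ)))
               (λ ψ → (x : Setoid.Carrier (Combs.Comb∞ 𝒞 (Combs.const 𝒞 (SymMonCat.unit 𝒞)) Y))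
                      (n : ℕ) →
                      Setoid._≈_ (Combs.CoendT 𝒞 (Combs.⨂ 𝒞 Y n))
                        (proj₁ (Inverse.to ψ x) n) (Inverse.to (φ n) (proj₁ x n))))
mainTheorem2 𝒞 Y =
    comb-bijection Y
  , comb⁺-bijection Y
  , lim-inverse (λ n → Comb⁺ n unitFam Y) (λ n → CoendT (⨂ Y n)) proj⁺ proj⁺-cong (comb⁺-bijection Y)
  where
  open Combs 𝒞
  open Development 𝒞
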